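{- Let $P$ be the set of all integer partitions and $D$ the set of partitions into distinct parts (each including the empty partition of $0$). Define $P^*_1:=\{\pi\in D:\#(\pi)\not\equiv 2 \pmod 3\}$, $P_2:=\{\pi\in P: \text{no part of }\pi\text{ is divisible by }3\}$, and $P^*_3:=\{\pi\in P:\#(\pi)\not\equiv 1\pmod 3\}$. For a partition $\pi$ let $\sigma^*(\pi)=1$ if $\#(\pi)\equiv 0\pmod 3$ and $\sigma^*(\pi)=0$ otherwise, and let $\mu^*(\pi):=\#(\pi)+\sigma^*(\pi)$. Then, as formal power series in $q$, \[ \sum_{\pi\in P^*_1}(-1)^{\mu^*(\pi)}q^{|\pi|}=\sum_{(\pi_1,\pi_2)\in P_2\times P^*_3}(-1)^{\sigma^*(\pi_2)}q^{|\pi_1|+|\pi_2|}. \]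
   Context: A partition of a non-negative integer $n$ is a non-increasing finite sequence of positive integers summing to $n$; the empty sequence is the unique partition of $0$. For a partition $\pi$, $|\pi|$ denotes the sum of its parts and $\#(\pi)$ its number of parts. -}

module Defs where

open import Data.Bool using (Bool; true; false; if_then_else_; not; _∧_)
open import Data.Nat using (ℕ; zero; suc; _+_; _*_; _∸_; _%_; _≡ᵇ_; _≤ᵇ_)
open import Data.List using (List; []; _∷_; [_]; _++_; map; concatMap; filter; upTo; replicate; length; sum; foldr)
open import Data.Integer as ℤ using (ℤ)
open import Relation.Nullary using (does)
open import Relation.Unary using (Decidable)
open import Data.List.Relation.Unary.Unique.DecPropositional Data.Nat._≟_ using (unique?)

-- A partition is represented as a non-increasing list of positive naturals.
-- partsLe n m : all partitions of n whose parts are all ≤ m (each exactly once),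
-- built by choosing the multiplicity k of the part m and recursing on m.
partsLe : ℕ → ℕ → List (List ℕ)
partsLe n zero = if n ≡ᵇ 0 then [ [] ] else []
partsLe n (suc m) =
  concatMap (λ k → map (replicate k (suc m) ++_) (partsLe (n ∸ k * suc m) m))
            (filterB (λ k → k * suc m ≤ᵇ n) (upTo (suc n)))
  where
  filterB : (ℕ → Bool) → List ℕ → List ℕ
  filterB p [] = []
  filterB p (x ∷ xs) = if p x then x ∷ filterB p xs else filterB p xs

partitions : ℕ → List (List ℕ)
partitions n = partsLe n n

#parts : List ℕ → ℕ
#parts = length

isDistinct : List ℕ → Bool
isDistinct π = does (unique? π)

inP1* : List ℕ → Bool
inP1* π = isDistinct π ∧ not (#parts π % 3 ≡ᵇ 2)

inP2 : List ℕ → Bool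
inP2 π = allB π
  where
  allB : List ℕ → Bool
  allB [] = true
  allB (p ∷ ps) = not (p % 3 ≡ᵇ 0) ∧ allB ps

inP3* : List ℕ → Bool
inP3* π = not (#parts π % 3 ≡ᵇ 1)

σ* : List ℕ → ℕ
σ* π = if #parts π % 3 ≡ᵇ 0 then 1 else 0

μ* : List ℕ → ℕ
μ* π = #parts π + σ* π

sgn : ℕ → ℤ
sgn k = if k % 2 ≡ᵇ 0 then ℤ.+ 1 else ℤ.- ℤ.+ 1

sumOver : (List ℕ → Bool) → (List ℕ → ℤ) → ℕ → ℤ
sumOver S w n = foldr (λ π acc → (if S π then w π else ℤ.+ 0) ℤ.+ acc) (ℤ.+ 0) (partitions n)

lhsCoeff : ℕ → ℤ
lhsCoeff n = sumOver inP1* (λ π → sgn (μ* π)) n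

rhsCoeff : ℕ → ℤ
rhsCoeff n = foldr (λ k acc → (sumOver inP2 (λ _ → ℤ.+ 1) k ℤ.* sumOver inP3* (λ π → sgn (σ* π)) (n ∸ k)) ℤ.+ acc)
                   (ℤ.+ 0) (upTo (suc n))

-- Over ℤ[ω], ω a primitive cube root of unity, the weighted partition sums are products:
-- ∑_{π ∈ D} (−ω)^#(π) q^|π| = ∏ (1 − ω qᵏ), ∑_{π ∈ P} ω^{2#(π)} q^|π| = ∏ 1/(1 − ω² qᵏ) and
-- ∑_{π ∈ P₂} q^|π| = ∏_{3∤k} 1/(1 − qᵏ).  Since (1 − ωx)(1 − ω²x)(1 − x) = 1 − x³, Glaisher's
-- argument gives ∏ (1 − ω qᵏ)(1 − ω² qᵏ) = ∏_{3∤k} 1/(1 − qᵏ), hence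
-- (∑_{P₂} q^|π|) · (∑_P ω^{2#(π)} q^|π|) = ∑_D (−ω)^#(π) q^|π|.  For the trace Tr of ℚ(ω)/ℚ and
-- α = ω² − 1, Tr(α (−ω)^ℓ) and Tr(α ω^{2ℓ}) are three times the signs (−1)^μ*, (−1)^σ* on the
-- partitions counted by the theorem and 0 on the others, so Tr(α ·) of the coefficients is three
-- times the claimed identity.  All products are finite: the coefficient of q^M only sees the
-- factors with k ≤ M.

module Submission where

open import Defs
open import Algebra.Bundles using (CommutativeRing; CommutativeMonoid)
open import Algebra.Core using (Op₁; Op₂)
open import Algebra.Structures using (IsCommutativeRing)
import Algebra.Properties.CommutativeSemigroup as CommutativeSemigroupProperties
import Algebra.Properties.Ring as RingProperties
import Algebra.Solver.Ring.AlmostCommutativeRing as AlmostCommutativeRing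
import Algebra.Solver.Ring.Simple as RingSolver
open import Data.Bool using (Bool; true; false; if_then_else_; not; _∧_)
import Data.Bool.Properties as Bool
open import Data.Bool.ListAction using (all)
open import Data.Integer as ℤ using (ℤ)
import Data.Integer.Properties as ℤ
open import Data.Integer.Solver using (module +-*-Solver)
open import Data.List using (List; []; _∷_; _++_; map; concatMap; foldr; upTo; applyUpTo; replicate; length)
open import Data.List.Properties using (map-upTo; ++-identityʳ; map-id; length-++; length-replicate)
open import Data.List.Relation.Unary.All as All using (All; []; _∷_; all?)
import Data.List.Relation.Unary.All.Properties as All
open import Data.List.Relation.Unary.AllPairs using (_∷_)
open import Data.Nat as ℕ using (ℕ; zero; suc; 2+; _≤_; _<_; z≤n; s≤s; _∸_; _%_; _≡ᵇ_; _≤ᵇ_)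
import Data.Nat.Properties as ℕ
open import Data.Nat.DivMod using (_/_; [m+kn]%n≡m%n; m≡m%n+[m/n]*n; m%n<n)
open import Data.Nat.Induction using (<-rec)
open import Data.List.Relation.Unary.Unique.DecPropositional ℕ._≟_ using (unique?)
open import Data.Product using (_,_)
open import Function using (_∘_)
open import Level using (0ℓ)
open import Relation.Binary.PropositionalEquality
open import Relation.Nullary using (Dec; yes; no; ¬?)
open import Relation.Nullary.Decidable using (dec-true; dec-false)

+-≤ᵇ-cancelˡ : ∀ j a b → (j ℕ.+ a ≤ᵇ j ℕ.+ b) ≡ (a ≤ᵇ b)
+-≤ᵇ-cancelˡ j a b with a ℕ.≤? b
... | yes a≤b = trans (dec-true (j ℕ.+ a ℕ.≤? j ℕ.+ b) (ℕ.+-monoʳ-≤ j a≤b)) (sym (dec-true (a ℕ.≤? b) a≤b))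
... | no  a≰b = trans (dec-false (j ℕ.+ a ℕ.≤? j ℕ.+ b) (a≰b ∘ ℕ.+-cancelˡ-≤ j a b)) (sym (dec-false (a ℕ.≤? b) a≰b))

block : ℕ → ℕ → ℕ → List (List ℕ)
block n m k =
  if k ℕ.* suc m ≤ᵇ n then map (replicate k (suc m) ++_) (partsLe (n ∸ k ℕ.* suc m) m) else []

concatMap-if : {A B : Set} (f : A → List B) (b : Bool) (x : A) {U : List A} {V : List B} →
  concatMap f U ≡ V → concatMap f (if b then x ∷ U else U) ≡ (if b then f x else []) ++ V
concatMap-if f true  x eq = cong (f x ++_) eq
concatMap-if f false x eq = eq

≡-by-list-induction : {A B : Set} {L R : List A → B} → L [] ≡ R [] →
  (∀ x xs → L xs ≡ R xs → L (x ∷ xs) ≡ R (x ∷ xs)) → ∀ xs → L xs ≡ R xs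
≡-by-list-induction eq[] eq∷ []       = eq[]
≡-by-list-induction eq[] eq∷ (x ∷ xs) = eq∷ x xs (≡-by-list-induction eq[] eq∷ xs)

-- Defs builds partsLe with a local filter, which unification plugs into the list induction.
partsLe-suc : ∀ n m → partsLe n (suc m) ≡ concatMap (block n m) (upTo (suc n))
partsLe-suc n m
  with ≡-by-list-induction {L = _} {R = _} refl
         (λ x _ → concatMap-if (λ k → map (replicate k (suc m) ++_) (partsLe (n ∸ k ℕ.* suc m) m))
                               (x ℕ.* suc m ≤ᵇ n) x)
     | applyUpTo suc n
... | eq | ks = cong (block n m 0 ++_) (eq ks)

partsLe-bounded : ∀ n m → All (All (_≤ m)) (partsLe n m)
partsLe-bounded zero    zero    = [] ∷ []
partsLe-bounded (suc n) zero    = []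
partsLe-bounded n       (suc m) rewrite partsLe-suc n m =
  All.concat⁺ (All.map⁺ {xs = upTo (suc n)} {f = block n m} (All.tabulate (λ {k} _ → block-bounded k)))
  where
  block-bounded : ∀ k → All (All (_≤ suc m)) (block n m k)
  block-bounded k with k ℕ.* suc m ≤ᵇ n
  ... | false = []
  ... | true  = All.map⁺ (All.map (λ bounded → All.++⁺ (All.replicate⁺ k ℕ.≤-refl) (All.map ℕ.m≤n⇒m≤1+n bounded))
                                  (partsLe-bounded (n ∸ k ℕ.* suc m) m))

concatMap-[] : {A B : Set} (f : A → List B) {xs : List A} → All (λ x → f x ≡ []) xs → concatMap f xs ≡ []
concatMap-[] f []         = refl
concatMap-[] f (eq ∷ eqs) rewrite eq = concatMap-[] f eqs

partsLe-stable-suc : ∀ {k m} → k ≤ m → partsLe k (suc m) ≡ partsLe k m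
partsLe-stable-suc {k} {m} k≤m = begin
  partsLe k (suc m)                                            ≡⟨ partsLe-suc k m ⟩
  map (λ π → π) (partsLe k m) ++ concatMap (block k m) (applyUpTo suc k)
    ≡⟨ cong₂ _++_ (map-id (partsLe k m)) (concatMap-[] (block k m) (All.applyUpTo⁺₂ suc k too-large)) ⟩
  partsLe k m ++ []                                            ≡⟨ ++-identityʳ (partsLe k m) ⟩
  partsLe k m                                                  ∎
  where
  open ≡-Reasoning
  too-large : ∀ i → block k m (suc i) ≡ []
  too-large i rewrite dec-false (suc i ℕ.* suc m ℕ.≤? k)
                        (λ le → ℕ.<⇒≱ (s≤s k≤m) (ℕ.≤-trans (ℕ.m≤m+n (suc m) (i ℕ.* suc m)) le)) = refl

partsLe-stable : ∀ {k n} → k ≤ n → partsLe k n ≡ partsLe k k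
partsLe-stable = stable ∘ ℕ.≤⇒≤′
  where
  stable : ∀ {k n} → k ℕ.≤′ n → partsLe k n ≡ partsLe k k
  stable (ℕ.≤′-reflexive refl) = refl
  stable (ℕ.≤′-step k≤′n)      = trans (partsLe-stable-suc (ℕ.≤′⇒≤ k≤′n)) (stable k≤′n)

-- Formal power series over a commutative ring

module PowerSeries
  {A : Set} {add mul : Op₂ A} {neg : Op₁ A} {zero# one# : A}
  (isCommutativeRing : IsCommutativeRing _≡_ add mul neg zero# one#) where

  private
    commutativeRing : CommutativeRing 0ℓ 0ℓ
    commutativeRing = record { isCommutativeRing = isCommutativeRing }

  open CommutativeRing commutativeRing
    using ( _+_; _*_; -_; 0#; 1#; +-assoc; +-comm; +-identityˡ; +-identityʳ; -‿inverseʳ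
          ; *-assoc; *-comm; *-identityˡ; distribˡ; distribʳ; zeroˡ; zeroʳ
          ; ring; +-commutativeSemigroup )
  open RingProperties ring using (+-cancelʳ; -‿distribˡ-*)
  open CommutativeSemigroupProperties +-commutativeSemigroup using (interchange; x∙yz≈y∙xz)

  ∑ : {B : Set} → (B → A) → List B → A
  ∑ f = foldr (λ x acc → f x + acc) 0#

  private variable B C : Set

  ∑-cong-All : {f g : B → A} {xs : List B} → All (λ x → f x ≡ g x) xs → ∑ f xs ≡ ∑ g xs
  ∑-cong-All []         = refl
  ∑-cong-All (eq ∷ eqs) = cong₂ _+_ eq (∑-cong-All eqs)

  ∑-cong : {f g : B → A} → f ≗ g → (xs : List B) → ∑ f xs ≡ ∑ g xs
  ∑-cong f≗g xs = ∑-cong-All (All.tabulate {xs = xs} (λ {x} _ → f≗g x))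

  ∑-zero : {f : B → A} (xs : List B) → (∀ x → f x ≡ 0#) → ∑ f xs ≡ 0#
  ∑-zero []       f≡0 = refl
  ∑-zero (x ∷ xs) f≡0 = trans (cong₂ _+_ (f≡0 x) (∑-zero xs f≡0)) (+-identityˡ 0#)

  ∑-++ : (f : B → A) (xs ys : List B) → ∑ f (xs ++ ys) ≡ ∑ f xs + ∑ f ys
  ∑-++ f []       ys = sym (+-identityˡ _)
  ∑-++ f (x ∷ xs) ys = trans (cong (f x +_) (∑-++ f xs ys)) (sym (+-assoc _ _ _))

  ∑-*ˡ : (c : A) (f : B → A) (xs : List B) → ∑ (λ x → c * f x) xs ≡ c * ∑ f xs
  ∑-*ˡ c f []       = sym (zeroʳ c)
  ∑-*ˡ c f (x ∷ xs) = trans (cong (c * f x +_) (∑-*ˡ c f xs)) (sym (distribˡ c _ _))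

  ∑-map : (f : C → A) (g : B → C) (xs : List B) → ∑ f (map g xs) ≡ ∑ (f ∘ g) xs
  ∑-map f g []       = refl
  ∑-map f g (x ∷ xs) = cong (f (g x) +_) (∑-map f g xs)

  ∑-concatMap : (f : C → A) (g : B → List C) (xs : List B) →
    ∑ f (concatMap g xs) ≡ ∑ (∑ f ∘ g) xs
  ∑-concatMap f g []       = refl
  ∑-concatMap f g (x ∷ xs) = trans (∑-++ f (g x) _) (cong (∑ f (g x) +_) (∑-concatMap f g xs))

  ∑-upTo-suc : (f : ℕ → A) (n : ℕ) → ∑ f (upTo (suc n)) ≡ f 0 + ∑ (f ∘ suc) (upTo n)
  ∑-upTo-suc f n = cong (f 0 +_) (trans (cong (∑ f) (sym (map-upTo suc n))) (∑-map f suc (upTo n)))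

  ∑-upTo-vanishing : (f : ℕ → A) (a b : ℕ) → (∀ k → a ≤ k → f k ≡ 0#) → ∑ f (upTo (a ℕ.+ b)) ≡ ∑ f (upTo a)
  ∑-upTo-vanishing f zero    b f≡0 = ∑-zero (upTo b) (λ k → f≡0 k z≤n)
  ∑-upTo-vanishing f (suc a) b f≡0 = begin
    ∑ f (upTo (suc a ℕ.+ b))                 ≡⟨ ∑-upTo-suc f (a ℕ.+ b) ⟩
    f 0 + ∑ (f ∘ suc) (upTo (a ℕ.+ b))      ≡⟨ cong (f 0 +_) (∑-upTo-vanishing (f ∘ suc) a b (λ k a≤k → f≡0 (suc k) (s≤s a≤k))) ⟩
    f 0 + ∑ (f ∘ suc) (upTo a)               ≡⟨ ∑-upTo-suc f a ⟨
    ∑ f (upTo (suc a))                       ∎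
    where open ≡-Reasoning

  Series : Set
  Series = ℕ → A

  infix 4 _≗[_]_
  _≗[_]_ : Series → ℕ → Series → Set
  F ≗[ M ] G = ∀ n → n ≤ M → F n ≡ G n

  ≗⇒≗[] : ∀ {F G} M → F ≗ G → F ≗[ M ] G
  ≗⇒≗[] M F≗G n _ = F≗G n

  ≗[]-trans : ∀ {F G H M} → F ≗[ M ] G → G ≗[ M ] H → F ≗[ M ] H
  ≗[]-trans F≗G G≗H n n≤M = trans (F≗G n n≤M) (G≗H n n≤M)

  𝟘 𝟙 : Series
  𝟘 _ = 0#
  𝟙 zero    = 1#
  𝟙 (suc _) = 0#

  infixl 6 _⊕_
  infixr 7 _•_
  infixl 7 _⊛_
  infixr 8 q^_·_

  _⊕_ : Series → Series → Series
  (F ⊕ G) n = F n + G n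

  _•_ : A → Series → Series
  (c • F) n = c * F n

  q^_·_ : ℕ → Series → Series
  (q^ zero  · F) n       = F n
  (q^ suc j · F) zero    = 0#
  (q^ suc j · F) (suc n) = (q^ j · F) n

  _⊛_ : Series → Series → Series
  (F ⊛ G) zero    = F 0 * G 0
  (F ⊛ G) (suc n) = F 0 * G (suc n) + ((F ∘ suc) ⊛ G) n

  q^-cong : ∀ j {F G} → F ≗ G → q^ j · F ≗ q^ j · G
  q^-cong zero    F≗G n       = F≗G n
  q^-cong (suc j) F≗G zero    = refl
  q^-cong (suc j) F≗G (suc n) = q^-cong j F≗G n

  q^-⊕ : ∀ j F G → q^ j · (F ⊕ G) ≗ q^ j · F ⊕ q^ j · G
  q^-⊕ zero    F G n       = refl
  q^-⊕ (suc j) F G zero    = sym (+-identityˡ 0#)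
  q^-⊕ (suc j) F G (suc n) = q^-⊕ j F G n

  q^-• : ∀ j c F → q^ j · (c • F) ≗ c • q^ j · F
  q^-• zero    c F n       = refl
  q^-• (suc j) c F zero    = sym (zeroʳ c)
  q^-• (suc j) c F (suc n) = q^-• j c F n

  q^-linear : ∀ j F c G n → (q^ j · (F ⊕ c • G)) n ≡ (q^ j · F) n + c * (q^ j · G) n
  q^-linear j F c G n = trans (q^-⊕ j F (c • G) n) (cong ((q^ j · F) n +_) (q^-• j c G n))

  q^-𝟘 : ∀ j → q^ j · 𝟘 ≗ 𝟘
  q^-𝟘 zero    n       = refl
  q^-𝟘 (suc j) zero    = refl
  q^-𝟘 (suc j) (suc n) = q^-𝟘 j n

  q^-q^ : ∀ i j F → q^ i · q^ j · F ≗ q^ (i ℕ.+ j) · F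
  q^-q^ zero    j F n       = refl
  q^-q^ (suc i) j F zero    = refl
  q^-q^ (suc i) j F (suc n) = q^-q^ i j F n

  q^-below : ∀ j F {n} → n < j → (q^ j · F) n ≡ 0#
  q^-below (suc j) F {zero}  _         = refl
  q^-below (suc j) F {suc n} (s≤s n<j) = q^-below j F n<j

  q^-at : ∀ j F n → (q^ j · F) (j ℕ.+ n) ≡ F n
  q^-at zero    F n = refl
  q^-at (suc j) F n = q^-at j F n

  q^-local : ∀ j {F G} n → (∀ k → k < n → F k ≡ G k) → (q^ suc j · F) n ≡ (q^ suc j · G) n
  q^-local j       zero    _   = refl
  q^-local zero    (suc n) F≡G = F≡G n ℕ.≤-refl
  q^-local (suc j) (suc n) F≡G = q^-local j n (λ k k<n → F≡G k (ℕ.m≤n⇒m≤1+n k<n))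

  ⊛-local : ∀ n {F F′ G G′} → (∀ k → k ≤ n → F k ≡ F′ k) → (∀ k → k ≤ n → G k ≡ G′ k) →
    (F ⊛ G) n ≡ (F′ ⊛ G′) n
  ⊛-local zero    F≡ G≡ = cong₂ _*_ (F≡ 0 z≤n) (G≡ 0 z≤n)
  ⊛-local (suc n) F≡ G≡ =
    cong₂ _+_ (cong₂ _*_ (F≡ 0 z≤n) (G≡ (suc n) ℕ.≤-refl))
              (⊛-local n (λ k k≤n → F≡ (suc k) (s≤s k≤n)) (λ k k≤n → G≡ k (ℕ.m≤n⇒m≤1+n k≤n)))

  ⊛-cong : ∀ {F F′ G G′} → F ≗ F′ → G ≗ G′ → F ⊛ G ≗ F′ ⊛ G′
  ⊛-cong F≗ G≗ n = ⊛-local n (λ k _ → F≗ k) (λ k _ → G≗ k)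

  ⊛-cong[] : ∀ {F F′ G G′ M} → F ≗[ M ] F′ → G ≗[ M ] G′ → F ⊛ G ≗[ M ] F′ ⊛ G′
  ⊛-cong[] F≗ G≗ n n≤M = ⊛-local n (λ k k≤n → F≗ k (ℕ.≤-trans k≤n n≤M)) (λ k k≤n → G≗ k (ℕ.≤-trans k≤n n≤M))

  ⊛-zeroˡ : ∀ G → 𝟘 ⊛ G ≗ 𝟘
  ⊛-zeroˡ G zero    = zeroˡ (G 0)
  ⊛-zeroˡ G (suc n) = trans (cong₂ _+_ (zeroˡ (G (suc n))) (⊛-zeroˡ G n)) (+-identityˡ 0#)

  ⊛-identityˡ : ∀ G → 𝟙 ⊛ G ≗ G
  ⊛-identityˡ G zero    = *-identityˡ (G 0)
  ⊛-identityˡ G (suc n) = trans (cong₂ _+_ (*-identityˡ (G (suc n))) (⊛-zeroˡ G n)) (+-identityʳ _)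

  ⊛-distribʳ : ∀ F F′ G → (F ⊕ F′) ⊛ G ≗ F ⊛ G ⊕ F′ ⊛ G
  ⊛-distribʳ F F′ G zero    = distribʳ (G 0) (F 0) (F′ 0)
  ⊛-distribʳ F F′ G (suc n) =
    trans (cong₂ _+_ (distribʳ (G (suc n)) (F 0) (F′ 0)) (⊛-distribʳ (F ∘ suc) (F′ ∘ suc) G n))
          (interchange _ _ _ _)

  ⊛-•ˡ : ∀ c F G → (c • F) ⊛ G ≗ c • (F ⊛ G)
  ⊛-•ˡ c F G zero    = *-assoc c (F 0) (G 0)
  ⊛-•ˡ c F G (suc n) =
    trans (cong₂ _+_ (*-assoc c (F 0) (G (suc n))) (⊛-•ˡ c (F ∘ suc) G n)) (sym (distribˡ c _ _))

  ⊛-q^ˡ : ∀ j F G → (q^ j · F) ⊛ G ≗ q^ j · (F ⊛ G)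
  ⊛-q^ˡ zero    F G n       = ⊛-local n (λ _ _ → refl) (λ _ _ → refl)
  ⊛-q^ˡ (suc j) F G zero    = zeroˡ (G 0)
  ⊛-q^ˡ (suc j) F G (suc n) =
    trans (cong₂ _+_ (zeroˡ (G (suc n))) (⊛-local n (λ _ _ → refl) (λ _ _ → refl)))
          (trans (+-identityˡ _) (⊛-q^ˡ j F G n))

  ⊛-unfold : ∀ F G → F ⊛ G ≗ F 0 • G ⊕ q^ 1 · ((F ∘ suc) ⊛ G)
  ⊛-unfold F G zero    = sym (+-identityʳ _)
  ⊛-unfold F G (suc n) = refl

  ⊛-assoc : ∀ F G H → (F ⊛ G) ⊛ H ≗ F ⊛ (G ⊛ H)
  ⊛-assoc F G H zero    = *-assoc (F 0) (G 0) (H 0)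
  ⊛-assoc F G H (suc n) = begin
    ((F ⊛ G) ⊛ H) (suc n)                                              ≡⟨ ⊛-cong (⊛-unfold F G) (λ _ → refl) (suc n) ⟩
    ((F 0 • G ⊕ q^ 1 · ((F ∘ suc) ⊛ G)) ⊛ H) (suc n)                   ≡⟨ ⊛-distribʳ (F 0 • G) (q^ 1 · ((F ∘ suc) ⊛ G)) H (suc n) ⟩
    ((F 0 • G) ⊛ H) (suc n) + ((q^ 1 · ((F ∘ suc) ⊛ G)) ⊛ H) (suc n)    ≡⟨ cong₂ _+_ (⊛-•ˡ (F 0) G H (suc n)) (⊛-q^ˡ 1 _ H (suc n)) ⟩
    F 0 * (G ⊛ H) (suc n) + (((F ∘ suc) ⊛ G) ⊛ H) n                    ≡⟨ cong (F 0 * (G ⊛ H) (suc n) +_) (⊛-assoc (F ∘ suc) G H n) ⟩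
    (F ⊛ (G ⊛ H)) (suc n)                                              ∎
    where open ≡-Reasoning

  ⊛-comm : ∀ F G → F ⊛ G ≗ G ⊛ F
  ⊛-comm F G zero          = *-comm (F 0) (G 0)
  ⊛-comm F G (suc zero)    = trans (+-comm _ _) (cong₂ _+_ (*-comm (F 1) (G 0)) (*-comm (F 0) (G 1)))
  ⊛-comm F G (suc (suc n)) = begin
    F 0 * G (2+ n) + ((F ∘ suc) ⊛ G) (suc n)
      ≡⟨ cong (F 0 * G (2+ n) +_) (⊛-comm (F ∘ suc) G (suc n)) ⟩
    F 0 * G (2+ n) + (G 0 * F (2+ n) + ((G ∘ suc) ⊛ (F ∘ suc)) n)
      ≡⟨ cong (λ t → F 0 * G (2+ n) + (G 0 * F (2+ n) + t)) (⊛-comm (G ∘ suc) (F ∘ suc) n) ⟩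
    F 0 * G (2+ n) + (G 0 * F (2+ n) + ((F ∘ suc) ⊛ (G ∘ suc)) n)
      ≡⟨ x∙yz≈y∙xz _ _ _ ⟩
    G 0 * F (2+ n) + (F 0 * G (2+ n) + ((F ∘ suc) ⊛ (G ∘ suc)) n)
      ≡⟨ cong (G 0 * F (2+ n) +_) (⊛-comm F (G ∘ suc) (suc n)) ⟩
    (G ⊛ F) (suc (suc n))
      ∎
    where open ≡-Reasoning

  ⊛-∑ : ∀ F G n → (F ⊛ G) n ≡ ∑ (λ k → F k * G (n ∸ k)) (upTo (suc n))
  ⊛-∑ F G zero    = sym (+-identityʳ _)
  ⊛-∑ F G (suc n) = trans (cong (F 0 * G (suc n) +_) (⊛-∑ (F ∘ suc) G n))
                          (sym (∑-upTo-suc (λ k → F k * G (suc n ∸ k)) (suc n)))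

  ⊛-identityʳ : ∀ F → F ⊛ 𝟙 ≗ F
  ⊛-identityʳ F n = trans (⊛-comm F 𝟙 n) (⊛-identityˡ F n)

  ⊛-commutativeMonoid : CommutativeMonoid 0ℓ 0ℓ
  ⊛-commutativeMonoid = record
    { Carrier = Series ; _≈_ = _≗_ ; _∙_ = _⊛_ ; ε = 𝟙
    ; isCommutativeMonoid = record
      { isMonoid = record
        { isSemigroup = record
          { isMagma = record
            { isEquivalence = record { refl = λ _ → refl ; sym = λ eq n → sym (eq n) ; trans = λ e e′ n → trans (e n) (e′ n) }
            ; ∙-cong = ⊛-cong }
          ; assoc = ⊛-assoc }
        ; identity = ⊛-identityˡ , ⊛-identityʳ }
      ; comm = ⊛-comm } }

  module ⊛ = CommutativeSemigroupProperties (CommutativeMonoid.commutativeSemigroup ⊛-commutativeMonoid)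

  ⊛-cancelˡ : ∀ {F G H M} → F 0 ≡ 1# → F ⊛ G ≗[ M ] F ⊛ H → G ≗[ M ] H
  ⊛-cancelˡ {F} {G} {H} {M} F0≡1 FG≗FH = <-rec (λ n → n ≤ M → G n ≡ H n) step
    where
    rest : Series → Series
    rest K = q^ 1 · ((F ∘ suc) ⊛ K)

    -- rest K n only involves the coefficients of K below n.
    split : ∀ K n → (F ⊛ K) n ≡ K n + rest K n
    split K n = trans (⊛-unfold F K n) (cong (_+ rest K n) (trans (cong (_* K n) F0≡1) (*-identityˡ (K n))))

    step : ∀ n → (∀ {k} → k < n → k ≤ M → G k ≡ H k) → n ≤ M → G n ≡ H n
    step n ih n≤M = +-cancelʳ (rest G n) (G n) (H n) (begin
      G n + rest G n   ≡⟨ split G n ⟨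
      (F ⊛ G) n        ≡⟨ FG≗FH n n≤M ⟩
      (F ⊛ H) n        ≡⟨ split H n ⟩
      H n + rest H n   ≡⟨ cong (H n +_) (q^-local 0 n (λ k k<n → ⊛-local k (λ _ _ → refl)
                             (λ i i≤k → ih (ℕ.≤-<-trans i≤k k<n) (ℕ.≤-trans (ℕ.≤-trans i≤k (ℕ.<⇒≤ k<n)) n≤M)))) ⟨
      H n + rest G n   ∎)
      where open ≡-Reasoning

  eulerFactor : A → ℕ → Series
  eulerFactor z j = 𝟙 ⊕ (- z) • q^ j · 𝟙

  eulerFactor-⊛ : ∀ z j F → eulerFactor z j ⊛ F ≗ F ⊕ (- z) • q^ j · F
  eulerFactor-⊛ z j F n = begin
    (eulerFactor z j ⊛ F) n                        ≡⟨ ⊛-distribʳ 𝟙 ((- z) • q^ j · 𝟙) F n ⟩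
    (𝟙 ⊛ F) n + (((- z) • q^ j · 𝟙) ⊛ F) n        ≡⟨ cong₂ _+_ (⊛-identityˡ F n) (⊛-•ˡ (- z) (q^ j · 𝟙) F n) ⟩
    F n + - z * ((q^ j · 𝟙) ⊛ F) n                 ≡⟨ cong (λ t → F n + - z * t) (trans (⊛-q^ˡ j 𝟙 F n) (q^-cong j (⊛-identityˡ F) n)) ⟩
    F n + - z * (q^ j · F) n                       ∎
    where open ≡-Reasoning

  eulerFactor-⊛-trivial : ∀ z j F {M} → M < j → eulerFactor z j ⊛ F ≗[ M ] F
  eulerFactor-⊛-trivial z j F M<j n n≤M = begin
    (eulerFactor z j ⊛ F) n     ≡⟨ eulerFactor-⊛ z j F n ⟩
    F n + - z * (q^ j · F) n    ≡⟨ cong (λ t → F n + - z * t) (q^-below j F (ℕ.≤-<-trans n≤M M<j)) ⟩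
    F n + - z * 0#              ≡⟨ cong (F n +_) (zeroʳ (- z)) ⟩
    F n + 0#                    ≡⟨ +-identityʳ (F n) ⟩
    F n                         ∎
    where open ≡-Reasoning

  eulerFactor-constant : ∀ z j → eulerFactor z (suc j) 0 ≡ 1#
  eulerFactor-constant z j = trans (cong (1# +_) (zeroʳ (- z))) (+-identityʳ 1#)

  ∏ : (ℕ → Series) → ℕ → Series
  ∏ F zero    = 𝟙
  ∏ F (suc m) = F (suc m) ⊛ ∏ F m

  ∏-cong : ∀ {F G} m → (∀ k → F k ≗ G k) → ∏ F m ≗ ∏ G m
  ∏-cong zero    F≗G n = refl
  ∏-cong (suc m) F≗G   = ⊛-cong (F≗G (suc m)) (∏-cong m F≗G)

  ∏-⊛ : ∀ F G m → ∏ F m ⊛ ∏ G m ≗ ∏ (λ k → F k ⊛ G k) m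
  ∏-⊛ F G zero            = ⊛-identityˡ 𝟙
  ∏-⊛ F G (suc m) n       =
    trans (⊛.interchange (F (suc m)) (∏ F m) (G (suc m)) (∏ G m) n) (⊛-cong (λ _ → refl) (∏-⊛ F G m) n)

  ∏-constant : ∀ F m → (∀ k → F (suc k) 0 ≡ 1#) → ∏ F m 0 ≡ 1#
  ∏-constant F zero    F0≡1 = refl
  ∏-constant F (suc m) F0≡1 = trans (cong₂ _*_ (F0≡1 m) (∏-constant F m F0≡1)) (*-identityˡ 1#)

  ∏-trivial : ∀ F {t m M} → t ≤ m → (∀ k G → t < k → F k ⊛ G ≗[ M ] G) → ∏ F m ≗[ M ] ∏ F t
  ∏-trivial F {t} {M = M} t≤m trivial = go (ℕ.≤⇒≤′ t≤m)
    where
    go : ∀ {m} → t ℕ.≤′ m → ∏ F m ≗[ M ] ∏ F t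
    go (ℕ.≤′-reflexive refl) n _ = refl
    go (ℕ.≤′-step {m} t≤′m)      = ≗[]-trans (trivial (suc m) (∏ F m) (s≤s (ℕ.≤′⇒≤ t≤′m))) (go t≤′m)

  ≗∏ : ∀ (S F : ℕ → Series) → S 0 ≗ 𝟙 → (∀ m → S (suc m) ≗ F (suc m) ⊛ S m) → ∀ m → S m ≗ ∏ F m
  ≗∏ S F S0≗𝟙 S-suc zero    = S0≗𝟙
  ≗∏ S F S0≗𝟙 S-suc (suc m) n = trans (S-suc m n) (⊛-cong (λ _ → refl) (≗∏ S F S0≗𝟙 S-suc m) n)

  ∏-inverse : ∀ (S F : ℕ → Series) → S 0 ≗ 𝟙 → (∀ m → F (suc m) ⊛ S (suc m) ≗ S m) → ∀ m → ∏ F m ⊛ S m ≗ 𝟙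
  ∏-inverse S F S0≗𝟙 F⊛S zero    n = trans (⊛-identityˡ (S 0) n) (S0≗𝟙 n)
  ∏-inverse S F S0≗𝟙 F⊛S (suc m) n =
    trans (⊛.xy∙z≈y∙xz (F (suc m)) (∏ F m) (S (suc m)) n)
          (trans (⊛-cong (λ _ → refl) (F⊛S m) n) (∏-inverse S F S0≗𝟙 F⊛S m n))

  -- plug c j F is C(q^j)·F for the power series C(x) = ∑ₖ c k xᵏ.
  plugTerm : (ℕ → A) → ℕ → Series → ℕ → ℕ → A
  plugTerm c j F n k = if k ℕ.* j ≤ᵇ n then c k * F (n ∸ k ℕ.* j) else 0#

  plug : (ℕ → A) → ℕ → Series → Series
  plug c j F n = ∑ (plugTerm c j F n) (upTo (suc n))

  plugTerm-vanishing : ∀ c j F {n} k → n < k ℕ.* j → plugTerm c j F n k ≡ 0#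
  plugTerm-vanishing c j F {n} k n<kj rewrite dec-false (k ℕ.* j ℕ.≤? n) (ℕ.<⇒≱ n<kj) = refl

  plugTerm-shift : ∀ c j F n k → plugTerm c j F (j ℕ.+ n) (suc k) ≡ plugTerm (c ∘ suc) j F n k
  plugTerm-shift c j F n k rewrite +-≤ᵇ-cancelˡ j (k ℕ.* j) n | ℕ.[m+n]∸[m+o]≡n∸o j n (k ℕ.* j) = refl

  plug-unfold : ∀ c m F → plug c (suc m) F ≗ c 0 • F ⊕ q^ suc m · plug (c ∘ suc) (suc m) F
  plug-unfold c m F n with suc m ℕ.≤? n
  ... | no j≰n = trans (∑-upTo-suc (plugTerm c j F n) n)
                        (cong (c 0 * F n +_) (trans tail≡0 (sym (q^-below j (plug (c ∘ suc) j F) n<j))))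
    where
    j = suc m
    n<j = ℕ.≰⇒> j≰n
    tail≡0 : ∑ (plugTerm c j F n ∘ suc) (upTo n) ≡ 0#
    tail≡0 = ∑-zero (upTo n) λ k → plugTerm-vanishing c j F (suc k) (ℕ.<-≤-trans n<j (ℕ.m≤m+n j (k ℕ.* j)))
  ... | yes j≤n = subst (λ n → plug c j F n ≡ (c 0 • F ⊕ q^ j · plug (c ∘ suc) j F) n) (ℕ.m+[n∸m]≡n j≤n)
                     (shifted (n ∸ j))
    where
    j = suc m
    open ≡-Reasoning
    shifted : ∀ n′ → plug c j F (j ℕ.+ n′) ≡ c 0 * F (j ℕ.+ n′) + (q^ j · plug (c ∘ suc) j F) (j ℕ.+ n′)
    shifted n′ = trans (∑-upTo-suc (plugTerm c j F (j ℕ.+ n′)) (j ℕ.+ n′)) (cong (c 0 * F (j ℕ.+ n′) +_) (begin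
      ∑ (plugTerm c j F (j ℕ.+ n′) ∘ suc) (upTo (j ℕ.+ n′))    ≡⟨ ∑-cong (plugTerm-shift c j F n′) (upTo (j ℕ.+ n′)) ⟩
      ∑ (plugTerm (c ∘ suc) j F n′) (upTo (j ℕ.+ n′))
        ≡⟨ cong (λ l → ∑ (plugTerm (c ∘ suc) j F n′) (upTo l)) (cong suc (ℕ.+-comm m n′)) ⟩
      ∑ (plugTerm (c ∘ suc) j F n′) (upTo (suc n′ ℕ.+ m))
        ≡⟨ ∑-upTo-vanishing _ (suc n′) m (λ k n′<k → plugTerm-vanishing (c ∘ suc) j F k (ℕ.<-≤-trans n′<k (ℕ.m≤m*n k j))) ⟩
      plug (c ∘ suc) j F n′                                    ≡⟨ q^-at j (plug (c ∘ suc) j F) n′ ⟨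
      (q^ j · plug (c ∘ suc) j F) (j ℕ.+ n′)                   ∎))

  plug-cong : ∀ {c c′} j F → (∀ k → c k ≡ c′ k) → plug c j F ≗ plug c′ j F
  plug-cong {c} {c′} j F c≡c′ n = ∑-cong term≡ (upTo (suc n))
    where
    term≡ : ∀ k → plugTerm c j F n k ≡ plugTerm c′ j F n k
    term≡ k with k ℕ.* j ≤ᵇ n
    ... | true  = cong (_* F (n ∸ k ℕ.* j)) (c≡c′ k)
    ... | false = refl

  plug-• : ∀ z c j F → plug (λ k → z * c k) j F ≗ z • plug c j F
  plug-• z c j F n = trans (∑-cong term≡ (upTo (suc n))) (∑-*ˡ z (plugTerm c j F n) (upTo (suc n)))
    where
    term≡ : ∀ k → plugTerm (λ k → z * c k) j F n k ≡ z * plugTerm c j F n k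
    term≡ k with k ℕ.* j ≤ᵇ n
    ... | true  = *-assoc z (c k) (F (n ∸ k ℕ.* j))
    ... | false = sym (zeroʳ z)

  plug-tail-zero : ∀ c m F → (∀ k → c (suc k) ≡ 0#) → plug c (suc m) F ≗ c 0 • F
  plug-tail-zero c m F c≡0 n = begin
    plug c (suc m) F n                                        ≡⟨ plug-unfold c m F n ⟩
    c 0 * F n + (q^ suc m · plug (c ∘ suc) (suc m) F) n       ≡⟨ cong (c 0 * F n +_) (q^-cong (suc m) plug≡0 n) ⟩
    c 0 * F n + (q^ suc m · 𝟘) n                              ≡⟨ cong (c 0 * F n +_) (q^-𝟘 (suc m) n) ⟩
    c 0 * F n + 0#                                            ≡⟨ +-identityʳ _ ⟩
    c 0 * F n                                                 ∎
    where
    open ≡-Reasoning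
    plug≡0 : plug (c ∘ suc) (suc m) F ≗ 𝟘
    plug≡0 n = trans (plug-cong (suc m) F (λ k → trans (c≡0 k) (sym (zeroˡ 0#))) n)
                     (trans (plug-• 0# (λ _ → 0#) (suc m) F n) (zeroˡ _))

  plug-constant : ∀ c m F → c 0 ≡ 1# → (∀ k → c (suc k) ≡ 0#) → plug c (suc m) F ≗ F
  plug-constant c m F c0≡1 c≡0 n =
    trans (plug-tail-zero c m F c≡0 n) (trans (cong (_* F n) c0≡1) (*-identityˡ (F n)))

  plug-linear : ∀ z c m F → c 0 ≡ 1# → c 1 ≡ - z → (∀ k → c (2+ k) ≡ 0#) →
    plug c (suc m) F ≗ eulerFactor z (suc m) ⊛ F
  plug-linear z c m F c0≡1 c1≡-z c≡0 n = begin
    plug c (suc m) F n                                           ≡⟨ plug-unfold c m F n ⟩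
    c 0 * F n + (q^ suc m · plug (c ∘ suc) (suc m) F) n          ≡⟨ cong₂ _+_ (trans (cong (_* F n) c0≡1) (*-identityˡ (F n)))
                                                                      (trans (q^-cong (suc m) (plug-tail-zero (c ∘ suc) m F c≡0) n)
                                                                             (q^-• (suc m) (c 1) F n)) ⟩
    F n + c 1 * (q^ suc m · F) n                                 ≡⟨ cong (λ t → F n + t * (q^ suc m · F) n) c1≡-z ⟩
    F n + - z * (q^ suc m · F) n                                 ≡⟨ eulerFactor-⊛ z (suc m) F n ⟨
    (eulerFactor z (suc m) ⊛ F) n                                ∎
    where open ≡-Reasoning

  plug-geometric : ∀ z c m F → c 0 ≡ 1# → (∀ k → c (suc k) ≡ z * c k) →
    eulerFactor z (suc m) ⊛ plug c (suc m) F ≗ F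
  plug-geometric z c m F c0≡1 c-step n = begin
    (eulerFactor z j ⊛ G) n               ≡⟨ eulerFactor-⊛ z j G n ⟩
    G n + - z * s                         ≡⟨ cong (_+ - z * s) G-rec ⟩
    (F n + z * s) + - z * s               ≡⟨ +-assoc (F n) (z * s) (- z * s) ⟩
    F n + (z * s + - z * s)               ≡⟨ cong (λ t → F n + (z * s + t)) (-‿distribˡ-* z s) ⟨
    F n + (z * s + - (z * s))             ≡⟨ cong (F n +_) (-‿inverseʳ (z * s)) ⟩
    F n + 0#                              ≡⟨ +-identityʳ (F n) ⟩
    F n                                   ∎
    where
    open ≡-Reasoning
    j = suc m
    G = plug c j F
    s = (q^ j · G) n
    G-rec : G n ≡ F n + z * s
    G-rec = begin
      G n                                       ≡⟨ plug-unfold c m F n ⟩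
      c 0 * F n + (q^ j · plug (c ∘ suc) j F) n  ≡⟨ cong₂ _+_ (trans (cong (_* F n) c0≡1) (*-identityˡ (F n)))
                                                     (q^-cong j (λ n′ → trans (plug-cong j F c-step n′) (plug-• z c j F n′)) n) ⟩
      F n + (q^ j · (z • G)) n                  ≡⟨ cong (F n +_) (q^-• j z G n) ⟩
      F n + z * s                               ∎

  partitionSum : (List ℕ → A) → ℕ → Series
  partitionSum W m n = ∑ W (partsLe n m)

  partitionSum-zero : ∀ W → W [] ≡ 1# → partitionSum W 0 ≗ 𝟙
  partitionSum-zero W W[]≡1 zero    = trans (+-identityʳ (W [])) W[]≡1
  partitionSum-zero W W[]≡1 (suc n) = refl

  partitionSum-suc : ∀ W c m → (∀ k π → All (_≤ m) π → W (replicate k (suc m) ++ π) ≡ c k * W π) →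
    partitionSum W (suc m) ≗ plug c (suc m) (partitionSum W m)
  partitionSum-suc W c m factor n = begin
    ∑ W (partsLe n (suc m))                       ≡⟨ cong (∑ W) (partsLe-suc n m) ⟩
    ∑ W (concatMap (block n m) (upTo (suc n)))    ≡⟨ ∑-concatMap W (block n m) (upTo (suc n)) ⟩
    ∑ (∑ W ∘ block n m) (upTo (suc n))            ≡⟨ ∑-cong block-sum (upTo (suc n)) ⟩
    plug c (suc m) (partitionSum W m) n           ∎
    where
    open ≡-Reasoning
    block-sum : ∀ k → ∑ W (block n m k) ≡ plugTerm c (suc m) (partitionSum W m) n k
    block-sum k with k ℕ.* suc m ≤ᵇ n
    ... | false = refl
    ... | true  = begin
      ∑ W (map (replicate k (suc m) ++_) π′s)        ≡⟨ ∑-map W (replicate k (suc m) ++_) π′s ⟩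
      ∑ (W ∘ (replicate k (suc m) ++_)) π′s          ≡⟨ ∑-cong-All (All.map (factor k _) (partsLe-bounded _ m)) ⟩
      ∑ (λ π → c k * W π) π′s                        ≡⟨ ∑-*ˡ (c k) W π′s ⟩
      c k * ∑ W π′s                                  ∎
      where π′s = partsLe (n ∸ k ℕ.* suc m) m

-- The Eisenstein integers

module Eisenstein where

  -- ⟨ a , b ⟩ stands for a + bω, where ω² = -1 - ω.
  data ℤω : Set where
    ⟨_,_⟩ : ℤ → ℤ → ℤω

  infixl 6 _+_
  infixl 7 _*_
  infix  8 -_

  _+_ : ℤω → ℤω → ℤω
  ⟨ a , b ⟩ + ⟨ c , d ⟩ = ⟨ a ℤ.+ c , b ℤ.+ d ⟩

  _*_ : ℤω → ℤω → ℤω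
  ⟨ a , b ⟩ * ⟨ c , d ⟩ = ⟨ a ℤ.* c ℤ.- b ℤ.* d , a ℤ.* d ℤ.+ b ℤ.* c ℤ.- b ℤ.* d ⟩

  -_ : ℤω → ℤω
  - ⟨ a , b ⟩ = ⟨ ℤ.- a , ℤ.- b ⟩

  0# 1# ω : ℤω
  0# = ⟨ ℤ.+ 0 , ℤ.+ 0 ⟩
  1# = ⟨ ℤ.+ 1 , ℤ.+ 0 ⟩
  ω  = ⟨ ℤ.+ 0 , ℤ.+ 1 ⟩

  private
    ⟨,⟩-cong : ∀ {a b c d} → a ≡ c → b ≡ d → ⟨ a , b ⟩ ≡ ⟨ c , d ⟩
    ⟨,⟩-cong refl refl = refl

    open +-*-Solver using (solve; _:+_; _:*_; _:-_; _:=_; con)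

  isCommutativeRing : IsCommutativeRing _≡_ _+_ _*_ -_ 0# 1#
  isCommutativeRing = record
    { isRing = record
      { +-isAbelianGroup = record
        { isGroup = record
          { isMonoid = record
            { isSemigroup = record
              { isMagma = record { isEquivalence = isEquivalence ; ∙-cong = cong₂ _+_ }
              ; assoc   = λ { ⟨ a , b ⟩ ⟨ c , d ⟩ ⟨ e , f ⟩ → ⟨,⟩-cong (ℤ.+-assoc a c e) (ℤ.+-assoc b d f) } }
            ; identity = (λ { ⟨ a , b ⟩ → ⟨,⟩-cong (ℤ.+-identityˡ a) (ℤ.+-identityˡ b) })
                       , (λ { ⟨ a , b ⟩ → ⟨,⟩-cong (ℤ.+-identityʳ a) (ℤ.+-identityʳ b) }) }
          ; inverse = (λ { ⟨ a , b ⟩ → ⟨,⟩-cong (ℤ.+-inverseˡ a) (ℤ.+-inverseˡ b) })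
                    , (λ { ⟨ a , b ⟩ → ⟨,⟩-cong (ℤ.+-inverseʳ a) (ℤ.+-inverseʳ b) })
          ; ⁻¹-cong = cong -_ }
        ; comm = λ { ⟨ a , b ⟩ ⟨ c , d ⟩ → ⟨,⟩-cong (ℤ.+-comm a c) (ℤ.+-comm b d) } }
      ; *-cong     = cong₂ _*_
      ; *-assoc    = *-assoc
      ; *-identity = *-identityˡ , λ x → trans (*-comm x 1#) (*-identityˡ x)
      ; distrib    = *-distribˡ , λ x y z → trans (*-comm (y + z) x) (trans (*-distribˡ x y z) (cong₂ _+_ (*-comm x y) (*-comm x z))) }
    ; *-comm = *-comm }
    where
    *-comm : ∀ x y → x * y ≡ y * x
    *-comm ⟨ a , b ⟩ ⟨ c , d ⟩ =
      ⟨,⟩-cong (solve 4 (λ a b c d → a :* c :- b :* d := c :* a :- d :* b) refl a b c d)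
               (solve 4 (λ a b c d → a :* d :+ b :* c :- b :* d := c :* b :+ d :* a :- d :* b) refl a b c d)

    *-assoc : ∀ x y z → (x * y) * z ≡ x * (y * z)
    *-assoc ⟨ a , b ⟩ ⟨ c , d ⟩ ⟨ e , f ⟩ =
      ⟨,⟩-cong (solve 6 (λ a b c d e f → (a :* c :- b :* d) :* e :- (a :* d :+ b :* c :- b :* d) :* f
                         := a :* (c :* e :- d :* f) :- b :* (c :* f :+ d :* e :- d :* f)) refl a b c d e f)
               (solve 6 (λ a b c d e f → (a :* c :- b :* d) :* f :+ (a :* d :+ b :* c :- b :* d) :* e :- (a :* d :+ b :* c :- b :* d) :* f
                         := a :* (c :* f :+ d :* e :- d :* f) :+ b :* (c :* e :- d :* f) :- b :* (c :* f :+ d :* e :- d :* f)) refl a b c d e f)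

    *-identityˡ : ∀ x → 1# * x ≡ x
    *-identityˡ ⟨ a , b ⟩ = ⟨,⟩-cong (solve 2 (λ a b → con (ℤ.+ 1) :* a :- con (ℤ.+ 0) :* b := a) refl a b)
                                     (solve 2 (λ a b → con (ℤ.+ 1) :* b :+ con (ℤ.+ 0) :* a :- con (ℤ.+ 0) :* b := b) refl a b)

    *-distribˡ : ∀ x y z → x * (y + z) ≡ x * y + x * z
    *-distribˡ ⟨ a , b ⟩ ⟨ c , d ⟩ ⟨ e , f ⟩ =
      ⟨,⟩-cong (solve 6 (λ a b c d e f → a :* (c :+ e) :- b :* (d :+ f) := (a :* c :- b :* d) :+ (a :* e :- b :* f)) refl a b c d e f)
               (solve 6 (λ a b c d e f → a :* (d :+ f) :+ b :* (c :+ e) :- b :* (d :+ f)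
                         := (a :* d :+ b :* c :- b :* d) :+ (a :* f :+ b :* e :- b :* f)) refl a b c d e f)

  commutativeRing : CommutativeRing 0ℓ 0ℓ
  commutativeRing = record { isCommutativeRing = isCommutativeRing }

  _≟_ : (x y : ℤω) → Dec (x ≡ y)
  ⟨ a , b ⟩ ≟ ⟨ c , d ⟩ with a ℤ.≟ c | b ℤ.≟ d
  ... | yes refl | yes refl = yes refl
  ... | no a≢c   | _        = no λ { refl → a≢c refl }
  ... | _        | no b≢d   = no λ { refl → b≢d refl }

  module Solver = RingSolver (AlmostCommutativeRing.fromCommutativeRing commutativeRing) _≟_

open Eisenstein using (ℤω; ⟨_,_⟩; _+_; _*_; -_; 0#; 1#; ω)
open CommutativeRing Eisenstein.commutativeRing using (*-identityˡ; zeroˡ; zeroʳ; semiring)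
open import Algebra.Properties.Semiring.Exp semiring using (_^_; ^-homo-*)
open PowerSeries Eisenstein.isCommutativeRing

-- The three generating functions

ω² : ℤω
ω² = ω * ω

if-*ʳ : ∀ b x y → (if b then x * y else 0#) ≡ x * (if b then y else 0#)
if-*ʳ true  x y = refl
if-*ʳ false x y = sym (zeroʳ x)

distinctWeight : List ℕ → ℤω
distinctWeight π = if isDistinct π then (- ω) ^ length π else 0#

distinctCoefficient : ℕ → ℤω
distinctCoefficient 0      = 1#
distinctCoefficient 1      = - ω
distinctCoefficient (2+ _) = 0#

distinctWeight-factor : ∀ m k π → All (_≤ m) π →
  distinctWeight (replicate k (suc m) ++ π) ≡ distinctCoefficient k * distinctWeight π
distinctWeight-factor m 0      π _ = sym (*-identityˡ _)
distinctWeight-factor m 1      π bounded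
  rewrite dec-true (all? (λ p → ¬? (suc m ℕ.≟ p)) π) (All.map (λ p≤m → ℕ.<⇒≢ (s≤s p≤m) ∘ sym) bounded) =
  if-*ʳ (isDistinct π) (- ω) _
distinctWeight-factor m (2+ k) π _
  rewrite dec-false (unique? (suc m ∷ suc m ∷ replicate k (suc m) ++ π)) (λ { ((m≢m ∷ _) ∷ _) → m≢m refl }) =
  sym (zeroˡ _)

ω²Weight : List ℕ → ℤω
ω²Weight π = ω² ^ length π

ω²Weight-factor : ∀ m k π → All (_≤ m) π → ω²Weight (replicate k (suc m) ++ π) ≡ ω² ^ k * ω²Weight π
ω²Weight-factor m k π _ =
  trans (cong (ω² ^_) (trans (length-++ (replicate k (suc m))) (cong (ℕ._+ length π) (length-replicate k))))
        (^-homo-* ω² k (length π))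

isMultipleOf3 : ℕ → Bool
isMultipleOf3 p = p % 3 ≡ᵇ 0

all-++ : {A : Set} (p : A → Bool) (xs ys : List A) → all p (xs ++ ys) ≡ (all p xs ∧ all p ys)
all-++ p []       ys = refl
all-++ p (x ∷ xs) ys = trans (cong (p x ∧_) (all-++ p xs ys)) (sym (Bool.∧-assoc (p x) _ _))

nonMultipleWeight : List ℕ → ℤω
nonMultipleWeight π = if all (not ∘ isMultipleOf3) π then 1# else 0#

nonMultipleCoefficient : ℕ → ℕ → ℤω
nonMultipleCoefficient m k = nonMultipleWeight (replicate k (suc m))

nonMultipleWeight-factor : ∀ m k π → All (_≤ m) π →
  nonMultipleWeight (replicate k (suc m) ++ π) ≡ nonMultipleCoefficient m k * nonMultipleWeight π
nonMultipleWeight-factor m k π _ rewrite all-++ (not ∘ isMultipleOf3) (replicate k (suc m)) π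
  with all (not ∘ isMultipleOf3) (replicate k (suc m))
... | true  = sym (*-identityˡ _)
... | false = sym (zeroˡ _)

distinctSeries ω²Series nonMultipleSeries : ℕ → Series
distinctSeries    = partitionSum distinctWeight
ω²Series          = partitionSum ω²Weight
nonMultipleSeries = partitionSum nonMultipleWeight

distinctSeries≗∏ : ∀ m → distinctSeries m ≗ ∏ (eulerFactor ω) m
distinctSeries≗∏ = ≗∏ distinctSeries (eulerFactor ω) (partitionSum-zero distinctWeight refl) λ m n →
  trans (partitionSum-suc distinctWeight distinctCoefficient m (distinctWeight-factor m) n)
        (plug-linear ω distinctCoefficient m (distinctSeries m) refl refl (λ _ → refl) n)

ω²Series-inverse : ∀ m → ∏ (eulerFactor ω²) m ⊛ ω²Series m ≗ 𝟙
ω²Series-inverse = ∏-inverse ω²Series (eulerFactor ω²) (partitionSum-zero ω²Weight refl) λ m n →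
  trans (⊛-cong (λ _ → refl) (partitionSum-suc ω²Weight (ω² ^_) m (ω²Weight-factor m)) n)
        (plug-geometric ω² (ω² ^_) m (ω²Series m) refl (λ _ → refl) n)

nonMultipleFactor : ℕ → Series
nonMultipleFactor k = if isMultipleOf3 k then 𝟙 else eulerFactor 1# k

nonMultipleSeries-inverse : ∀ m → ∏ nonMultipleFactor m ⊛ nonMultipleSeries m ≗ 𝟙
nonMultipleSeries-inverse = ∏-inverse nonMultipleSeries nonMultipleFactor (partitionSum-zero nonMultipleWeight refl) step
  where
  c = nonMultipleCoefficient
  recursion : ∀ m → nonMultipleSeries (suc m) ≗ plug (c m) (suc m) (nonMultipleSeries m)
  recursion m = partitionSum-suc nonMultipleWeight (c m) m (nonMultipleWeight-factor m)

  -- c m (suc k), with isMultipleOf3 (suc m) abstracted as b.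
  rest : ℕ → ℕ → Bool → ℤω
  rest m k b = if not b ∧ all (not ∘ isMultipleOf3) (replicate k (suc m)) then 1# else 0#

  step : ∀ m → nonMultipleFactor (suc m) ⊛ nonMultipleSeries (suc m) ≗ nonMultipleSeries m
  step m n with isMultipleOf3 (suc m) in eq
  ... | true  = trans (⊛-identityˡ _ n) (trans (recursion m n)
                  (plug-constant (c m) m (nonMultipleSeries m) refl (λ k → cong (rest m k) eq) n))
  ... | false = trans (⊛-cong (λ _ → refl) (recursion m) n)
                  (plug-geometric 1# (c m) m (nonMultipleSeries m) refl
                     (λ k → trans (cong (rest m k) eq) (sym (*-identityˡ _))) n)

eulerFactor-cube : ∀ j → eulerFactor ω j ⊛ eulerFactor ω² j ⊛ eulerFactor 1# j ≗ eulerFactor 1# (j ℕ.* 3)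
eulerFactor-cube j n = begin
  (eulerFactor ω j ⊛ eulerFactor ω² j ⊛ P) n                         ≡⟨ ⊛-assoc (eulerFactor ω j) (eulerFactor ω² j) P n ⟩
  (eulerFactor ω j ⊛ Q) n                                              ≡⟨ eulerFactor-⊛ ω j Q n ⟩
  Q n + - ω * (q^ j · Q) n                                             ≡⟨ cong₂ (λ a b → a + - ω * b) Q-at q^Q-at ⟩
  (d₀ + - 1# * d₁ + - ω² * (d₁ + - 1# * d₂))
    + - ω * ((d₁ + - 1# * d₂) + - ω² * (d₂ + - 1# * d₃))                ≡⟨ cubic d₀ d₁ d₂ d₃ ⟩
  d₀ + - 1# * d₃                                                       ≡⟨ cong (λ t → d₀ + - 1# * t) d₃-at ⟩
  eulerFactor 1# (j ℕ.* 3) n                                           ∎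
  where
  open ≡-Reasoning
  open Eisenstein.Solver using (solve; _:+_; _:*_; :-_; _:=_; con)
  P = eulerFactor 1# j
  Q = eulerFactor ω² j ⊛ P
  d₀ = 𝟙 n
  d₁ = (q^ j · 𝟙) n
  d₂ = (q^ j · q^ j · 𝟙) n
  d₃ = (q^ j · q^ j · q^ j · 𝟙) n

  cubic : ∀ a b c d → (a + - 1# * b + - ω² * (b + - 1# * c)) + - ω * ((b + - 1# * c) + - ω² * (c + - 1# * d))
                      ≡ a + - 1# * d
  cubic = solve 4 (λ a b c d →
    (a :+ con (- 1#) :* b :+ con (- ω²) :* (b :+ con (- 1#) :* c))
      :+ con (- ω) :* ((b :+ con (- 1#) :* c) :+ con (- ω²) :* (c :+ con (- 1#) :* d))
    := a :+ con (- 1#) :* d) refl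

  q^P : ∀ k → (q^ j · P) k ≡ (q^ j · 𝟙) k + - 1# * (q^ j · q^ j · 𝟙) k
  q^P = q^-linear j 𝟙 (- 1#) (q^ j · 𝟙)

  Q-at : Q n ≡ d₀ + - 1# * d₁ + - ω² * (d₁ + - 1# * d₂)
  Q-at = trans (eulerFactor-⊛ ω² j P n) (cong (λ t → P n + - ω² * t) (q^P n))

  q^Q-at : (q^ j · Q) n ≡ (d₁ + - 1# * d₂) + - ω² * (d₂ + - 1# * d₃)
  q^Q-at = begin
    (q^ j · Q) n                                        ≡⟨ q^-cong j (eulerFactor-⊛ ω² j P) n ⟩
    (q^ j · (P ⊕ - ω² • q^ j · P)) n                    ≡⟨ q^-linear j P (- ω²) (q^ j · P) n ⟩
    (q^ j · P) n + - ω² * (q^ j · q^ j · P) n           ≡⟨ cong₂ (λ a b → a + - ω² * b) (q^P n)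
                                                            (trans (q^-cong j q^P n) (q^-linear j (q^ j · 𝟙) (- 1#) (q^ j · q^ j · 𝟙) n)) ⟩
    (d₁ + - 1# * d₂) + - ω² * (d₂ + - 1# * d₃)          ∎

  d₃-at : d₃ ≡ (q^ j ℕ.* 3 · 𝟙) n
  d₃-at = begin
    d₃                              ≡⟨ q^-cong j (q^-q^ j j 𝟙) n ⟩
    (q^ j · q^ j ℕ.+ j · 𝟙) n       ≡⟨ q^-q^ j (j ℕ.+ j) 𝟙 n ⟩
    (q^ j ℕ.+ (j ℕ.+ j) · 𝟙) n      ≡⟨ cong (λ i → (q^ i · 𝟙) n) j+[j+j]≡j*3 ⟩
    (q^ j ℕ.* 3 · 𝟙) n              ∎
    where
    j+[j+j]≡j*3 : j ℕ.+ (j ℕ.+ j) ≡ j ℕ.* 3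
    j+[j+j]≡j*3 = trans (cong (λ t → j ℕ.+ (j ℕ.+ t)) (sym (ℕ.+-identityʳ j))) (ℕ.*-comm 3 j)

-- Glaisher's identity modulo q^(M+1)

tripledProduct multiplesProduct nonMultiplesProduct : ℕ → Series
tripledProduct      = ∏ (λ i → eulerFactor 1# (i ℕ.* 3))
multiplesProduct    = ∏ (λ k → if isMultipleOf3 k then eulerFactor 1# k else 𝟙)
nonMultiplesProduct = ∏ nonMultipleFactor

isMultipleOf3-+ : ∀ r t → isMultipleOf3 (r ℕ.+ t ℕ.* 3) ≡ isMultipleOf3 r
isMultipleOf3-+ r t = cong (_≡ᵇ 0) ([m+kn]%n≡m%n r t 3)

multiplesProduct-skip : ∀ n → isMultipleOf3 (suc n) ≡ false → multiplesProduct (suc n) ≗ multiplesProduct n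
multiplesProduct-skip n not3∣ k =
  trans (⊛-cong (λ i → cong (λ b → (if b then eulerFactor 1# (suc n) else 𝟙) i) not3∣) (λ _ → refl) k)
        (⊛-identityˡ (multiplesProduct n) k)

multiplesProduct-tripled : ∀ t r → r < 3 → multiplesProduct (r ℕ.+ t ℕ.* 3) ≗ tripledProduct t
multiplesProduct-tripled zero    0 _ k = refl
multiplesProduct-tripled (suc t) 0 _ k = begin
  multiplesProduct (3 ℕ.+ t ℕ.* 3) k                                      ≡⟨ ⊛-cong taken (λ _ → refl) k ⟩
  (eulerFactor 1# (3 ℕ.+ t ℕ.* 3) ⊛ multiplesProduct (2 ℕ.+ t ℕ.* 3)) k    ≡⟨ ⊛-cong (λ _ → refl) (multiplesProduct-tripled t 2 (s≤s (s≤s (s≤s z≤n)))) k ⟩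
  tripledProduct (suc t) k                                               ∎
  where
  open ≡-Reasoning
  taken : (if isMultipleOf3 (3 ℕ.+ t ℕ.* 3) then eulerFactor 1# (3 ℕ.+ t ℕ.* 3) else 𝟙) ≗ eulerFactor 1# (3 ℕ.+ t ℕ.* 3)
  taken i = cong (λ b → (if b then eulerFactor 1# (3 ℕ.+ t ℕ.* 3) else 𝟙) i) (isMultipleOf3-+ 3 t)
multiplesProduct-tripled t 1 _ k =
  trans (multiplesProduct-skip (t ℕ.* 3) (isMultipleOf3-+ 1 t) k) (multiplesProduct-tripled t 0 (s≤s z≤n) k)
multiplesProduct-tripled t 2 _ k =
  trans (multiplesProduct-skip (1 ℕ.+ t ℕ.* 3) (isMultipleOf3-+ 2 t) k) (multiplesProduct-tripled t 1 (s≤s (s≤s z≤n)) k)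
multiplesProduct-tripled t (2+ (suc _)) (s≤s (s≤s (s≤s ())))

multiplesProduct≗[]tripledProduct : ∀ M → multiplesProduct M ≗[ M ] tripledProduct M
multiplesProduct≗[]tripledProduct M =
  subst (λ K → multiplesProduct K ≗[ K ] tripledProduct K) (sym (m≡m%n+[m/n]*n M 3)) (agree (M % 3) (M / 3) (m%n<n M 3))
  where
  agree : ∀ r t → r < 3 → multiplesProduct (r ℕ.+ t ℕ.* 3) ≗[ r ℕ.+ t ℕ.* 3 ] tripledProduct (r ℕ.+ t ℕ.* 3)
  agree r t r<3 = ≗[]-trans (≗⇒≗[] _ (multiplesProduct-tripled t r r<3)) (λ n n≤ → sym (truncate n n≤))
    where
    truncate : tripledProduct (r ℕ.+ t ℕ.* 3) ≗[ r ℕ.+ t ℕ.* 3 ] tripledProduct t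
    truncate = ∏-trivial _ (ℕ.≤-trans (ℕ.m≤m*n t 3) (ℕ.m≤n+m (t ℕ.* 3) r)) λ k G t<k →
      eulerFactor-⊛-trivial 1# (k ℕ.* 3) G (ℕ.<-≤-trans (ℕ.+-monoˡ-< (t ℕ.* 3) r<3) (ℕ.*-monoˡ-≤ 3 t<k))

eulerProduct-split : ∀ M → ∏ (eulerFactor 1#) M ≗ multiplesProduct M ⊛ nonMultiplesProduct M
eulerProduct-split M n = sym (trans (∏-⊛ _ nonMultipleFactor M n) (∏-cong M split n))
  where
  split : ∀ k → (if isMultipleOf3 k then eulerFactor 1# k else 𝟙) ⊛ nonMultipleFactor k ≗ eulerFactor 1# k
  split k with isMultipleOf3 k
  ... | true  = ⊛-identityʳ (eulerFactor 1# k)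
  ... | false = ⊛-identityˡ (eulerFactor 1# k)

glaisher : ∀ M → nonMultipleSeries M ≗[ M ] ∏ (eulerFactor ω) M ⊛ ∏ (eulerFactor ω²) M
glaisher M = ⊛-cancelˡ (∏-constant (eulerFactor 1#) M (eulerFactor-constant 1#))
  (≗[]-trans (≗⇒≗[] M ΦN≗multiples) (≗[]-trans (multiplesProduct≗[]tripledProduct M) (≗⇒≗[] M tripled≗ΦD)))
  where
  open ≡-Reasoning
  Φ = ∏ (eulerFactor 1#) M
  D = ∏ (eulerFactor ω) M ⊛ ∏ (eulerFactor ω²) M

  ΦN≗multiples : Φ ⊛ nonMultipleSeries M ≗ multiplesProduct M
  ΦN≗multiples n = begin
    (Φ ⊛ nonMultipleSeries M) n                                              ≡⟨ ⊛-cong (eulerProduct-split M) (λ _ → refl) n ⟩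
    (multiplesProduct M ⊛ nonMultiplesProduct M ⊛ nonMultipleSeries M) n      ≡⟨ ⊛-assoc (multiplesProduct M) _ _ n ⟩
    (multiplesProduct M ⊛ (nonMultiplesProduct M ⊛ nonMultipleSeries M)) n    ≡⟨ ⊛-cong (λ _ → refl) (nonMultipleSeries-inverse M) n ⟩
    (multiplesProduct M ⊛ 𝟙) n                                               ≡⟨ ⊛-identityʳ (multiplesProduct M) n ⟩
    multiplesProduct M n                                                     ∎

  tripled≗ΦD : tripledProduct M ≗ Φ ⊛ D
  tripled≗ΦD n = sym (begin
    (Φ ⊛ D) n                                                                ≡⟨ ⊛-comm Φ D n ⟩
    (D ⊛ Φ) n                                                                ≡⟨ ⊛-cong (∏-⊛ (eulerFactor ω) (eulerFactor ω²) M) (λ _ → refl) n ⟩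
    (∏ (λ k → eulerFactor ω k ⊛ eulerFactor ω² k) M ⊛ Φ) n                  ≡⟨ ∏-⊛ _ (eulerFactor 1#) M n ⟩
    ∏ (λ k → eulerFactor ω k ⊛ eulerFactor ω² k ⊛ eulerFactor 1# k) M n     ≡⟨ ∏-cong M eulerFactor-cube n ⟩
    tripledProduct M n                                                       ∎)

nonMultiple⊛ω²≗[]distinct : ∀ M → nonMultipleSeries M ⊛ ω²Series M ≗[ M ] distinctSeries M
nonMultiple⊛ω²≗[]distinct M = ≗[]-trans (⊛-cong[] (glaisher M) (λ _ _ → refl)) (≗⇒≗[] M λ n → begin
  (∏ (eulerFactor ω) M ⊛ ∏ (eulerFactor ω²) M ⊛ ω²Series M) n     ≡⟨ ⊛-assoc (∏ (eulerFactor ω) M) _ _ n ⟩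
  (∏ (eulerFactor ω) M ⊛ (∏ (eulerFactor ω²) M ⊛ ω²Series M)) n   ≡⟨ ⊛-cong (λ _ → refl) (ω²Series-inverse M) n ⟩
  (∏ (eulerFactor ω) M ⊛ 𝟙) n                                     ≡⟨ ⊛-identityʳ _ n ⟩
  ∏ (eulerFactor ω) M n                                           ≡⟨ distinctSeries≗∏ M n ⟨
  distinctSeries M n                                              ∎)
  where open ≡-Reasoning

-- Recovering the integer coefficients

module ℤ∑ = PowerSeries ℤ.+-*-isCommutativeRing using (∑; ∑-*ˡ; ∑-cong; ∑-cong-All)
module ℤ* = CommutativeSemigroupProperties ℤ.*-commutativeSemigroup using (x∙yz≈y∙xz)
module ℤω* = CommutativeSemigroupProperties (CommutativeRing.*-commutativeSemigroup Eisenstein.commutativeRing) using (x∙yz≈y∙xz)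

ι : ℤ → ℤω
ι a = ⟨ a , ℤ.+ 0 ⟩

-- The trace of a + bω over ℚ, namely (a + bω) + (a + bω²).
trace : ℤω → ℤ
trace ⟨ a , b ⟩ = ℤ.+ 2 ℤ.* a ℤ.- b

trace-+ : ∀ x y → trace (x + y) ≡ trace x ℤ.+ trace y
trace-+ ⟨ a , b ⟩ ⟨ c , d ⟩ =
  solve 4 (λ a b c d → con (ℤ.+ 2) :* (a :+ c) :- (b :+ d) := (con (ℤ.+ 2) :* a :- b) :+ (con (ℤ.+ 2) :* c :- d)) refl a b c d
  where open +-*-Solver

trace-ι* : ∀ a x → trace (ι a * x) ≡ a ℤ.* trace x
trace-ι* a ⟨ c , d ⟩ =
  solve 3 (λ a c d → con (ℤ.+ 2) :* (a :* c :- con (ℤ.+ 0) :* d) :- (a :* d :+ con (ℤ.+ 0) :* c :- con (ℤ.+ 0) :* d)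
                     := a :* (con (ℤ.+ 2) :* c :- d)) refl a c d
  where open +-*-Solver

trace-∑ : {B : Set} (f : B → ℤω) (xs : List B) → trace (∑ f xs) ≡ ℤ∑.∑ (trace ∘ f) xs
trace-∑ f []       = refl
trace-∑ f (x ∷ xs) = trans (trace-+ (f x) (∑ f xs)) (cong (λ t → trace (f x) ℤ.+ t) (trace-∑ f xs))

ι-∑ : {B : Set} (f : B → ℤ) (xs : List B) → ι (ℤ∑.∑ f xs) ≡ ∑ (ι ∘ f) xs
ι-∑ f []       = refl
ι-∑ f (x ∷ xs) = cong (λ t → ι (f x) + t) (ι-∑ f xs)

α : ℤω
α = ω² + - 1#

%-periodic : ∀ n .{{_ : ℕ.NonZero n}} k x → (k ℕ.* n ℕ.+ x) % n ≡ x % n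
%-periodic n k x = trans (cong (_% n) (ℕ.+-comm (k ℕ.* n) x)) ([m+kn]%n≡m%n x k n)

sgn-periodic : ∀ x → sgn (6 ℕ.+ x) ≡ sgn x
sgn-periodic x rewrite %-periodic 2 3 x = refl

distinctSign : ℕ → ℤ
distinctSign ℓ = if not (ℓ % 3 ≡ᵇ 2) then sgn (ℓ ℕ.+ (if ℓ % 3 ≡ᵇ 0 then 1 else 0)) else ℤ.+ 0

trace-α*-ω^ : ∀ ℓ → trace (α * (- ω) ^ ℓ) ≡ ℤ.+ 3 ℤ.* distinctSign ℓ
trace-α*-ω^ 0 = refl
trace-α*-ω^ 1 = refl
trace-α*-ω^ 2 = refl
trace-α*-ω^ 3 = refl
trace-α*-ω^ 4 = refl
trace-α*-ω^ 5 = refl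
trace-α*-ω^ (suc (suc (suc (suc (suc (suc ℓ)))))) =
  trans (cong trace (cycle ((- ω) ^ ℓ))) (trans (trace-α*-ω^ ℓ) (cong (ℤ.+ 3 ℤ.*_) (sym periodic)))
  where
  open Eisenstein.Solver using (solve; _:*_; _:=_; con)
  cycle : ∀ x → α * (- ω * (- ω * (- ω * (- ω * (- ω * (- ω * x)))))) ≡ α * x
  cycle = solve 1 (λ x → con α :* (con (- ω) :* (con (- ω) :* (con (- ω) :* (con (- ω) :* (con (- ω) :* (con (- ω) :* x))))))
                         := con α :* x) refl
  periodic : distinctSign (6 ℕ.+ ℓ) ≡ distinctSign ℓ
  periodic rewrite %-periodic 3 2 ℓ =
    cong (λ s → if not (ℓ % 3 ≡ᵇ 2) then s else ℤ.+ 0) (sgn-periodic (ℓ ℕ.+ (if ℓ % 3 ≡ᵇ 0 then 1 else 0)))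

ω²Sign : ℕ → ℤ
ω²Sign r = if not (r ≡ᵇ 1) then sgn (if r ≡ᵇ 0 then 1 else 0) else ℤ.+ 0

trace-α*ω²^ : ∀ ℓ → trace (α * ω² ^ ℓ) ≡ ℤ.+ 3 ℤ.* ω²Sign (ℓ % 3)
trace-α*ω²^ 0 = refl
trace-α*ω²^ 1 = refl
trace-α*ω²^ 2 = refl
trace-α*ω²^ (suc (suc (suc ℓ))) =
  trans (cong trace (cycle (ω² ^ ℓ))) (trans (trace-α*ω²^ ℓ) (cong (λ r → ℤ.+ 3 ℤ.* ω²Sign r) (sym (%-periodic 3 1 ℓ))))
  where
  open Eisenstein.Solver using (solve; _:*_; _:=_; con)
  cycle : ∀ x → α * (ω² * (ω² * (ω² * x))) ≡ α * x
  cycle = solve 1 (λ x → con α :* (con ω² :* (con ω² :* (con ω² :* x))) := con α :* x) refl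

trace-α-∑ : ∀ (W : List ℕ → ℤω) (f : List ℕ → ℤ) → (∀ π → trace (α * W π) ≡ ℤ.+ 3 ℤ.* f π) →
  ∀ πs → ℤ.+ 3 ℤ.* ℤ∑.∑ f πs ≡ trace (α * ∑ W πs)
trace-α-∑ W f trace≡ πs = begin
  ℤ.+ 3 ℤ.* ℤ∑.∑ f πs              ≡⟨ ℤ∑.∑-*ˡ (ℤ.+ 3) f πs ⟨
  ℤ∑.∑ (λ π → ℤ.+ 3 ℤ.* f π) πs    ≡⟨ ℤ∑.∑-cong (λ π → sym (trace≡ π)) πs ⟩
  ℤ∑.∑ (λ π → trace (α * W π)) πs  ≡⟨ trace-∑ (λ π → α * W π) πs ⟨
  trace (∑ (λ π → α * W π) πs)     ≡⟨ cong trace (∑-*ˡ α W πs) ⟩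
  trace (α * ∑ W πs)               ∎
  where open ≡-Reasoning

lhsCoeff-trace : ∀ n → ℤ.+ 3 ℤ.* lhsCoeff n ≡ trace (α * distinctSeries n n)
lhsCoeff-trace n = trace-α-∑ distinctWeight _ trace-α*distinctWeight (partitions n)
  where
  trace-α*distinctWeight : ∀ π → trace (α * distinctWeight π) ≡ ℤ.+ 3 ℤ.* (if inP1* π then sgn (μ* π) else ℤ.+ 0)
  trace-α*distinctWeight π with isDistinct π
  ... | true  = trace-α*-ω^ (length π)
  ... | false = refl

ω²Coeff-trace : ∀ k → ℤ.+ 3 ℤ.* sumOver inP3* (λ π → sgn (σ* π)) k ≡ trace (α * ω²Series k k)
ω²Coeff-trace k = trace-α-∑ ω²Weight _ (trace-α*ω²^ ∘ length) (partitions k)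

-- inP2 is defined through a local fold, pinned down here by list induction.
inP2≡all : ∀ π → inP2 π ≡ all (not ∘ isMultipleOf3) π
inP2≡all = ≡-by-list-induction refl (λ p _ → cong (not (isMultipleOf3 p) ∧_))

nonMultipleCoeff-ι : ∀ k → ι (sumOver inP2 (λ _ → ℤ.+ 1) k) ≡ nonMultipleSeries k k
nonMultipleCoeff-ι k = trans (ι-∑ _ (partitions k)) (∑-cong weight (partitions k))
  where
  weight : ∀ π → ι (if inP2 π then ℤ.+ 1 else ℤ.+ 0) ≡ nonMultipleWeight π
  weight π rewrite inP2≡all π with all (not ∘ isMultipleOf3) π
  ... | true  = refl
  ... | false = refl

rhsCoeff-trace : ∀ n → ℤ.+ 3 ℤ.* rhsCoeff n ≡ trace (α * (nonMultipleSeries n ⊛ ω²Series n) n)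
rhsCoeff-trace n = begin
  ℤ.+ 3 ℤ.* ℤ∑.∑ (λ k → a k ℤ.* b (n ∸ k)) ks        ≡⟨ ℤ∑.∑-*ˡ (ℤ.+ 3) (λ k → a k ℤ.* b (n ∸ k)) ks ⟨
  ℤ∑.∑ (λ k → ℤ.+ 3 ℤ.* (a k ℤ.* b (n ∸ k))) ks      ≡⟨ ℤ∑.∑-cong-All (All.map term (All.all-upTo (suc n))) ⟩
  ℤ∑.∑ (λ k → trace (α * (N n k * Z n (n ∸ k)))) ks  ≡⟨ trace-∑ (λ k → α * (N n k * Z n (n ∸ k))) ks ⟨
  trace (∑ (λ k → α * (N n k * Z n (n ∸ k))) ks)     ≡⟨ cong trace (∑-*ˡ α (λ k → N n k * Z n (n ∸ k)) ks) ⟩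
  trace (α * ∑ (λ k → N n k * Z n (n ∸ k)) ks)       ≡⟨ cong (λ x → trace (α * x)) (⊛-∑ (N n) (Z n) n) ⟨
  trace (α * (N n ⊛ Z n) n)                          ∎
  where
  open ≡-Reasoning
  ks = upTo (suc n)
  N = nonMultipleSeries
  Z = ω²Series
  a = sumOver inP2 (λ _ → ℤ.+ 1)
  b = sumOver inP3* (λ π → sgn (σ* π))

  term : ∀ {k} → k < suc n → ℤ.+ 3 ℤ.* (a k ℤ.* b (n ∸ k)) ≡ trace (α * (N n k * Z n (n ∸ k)))
  term {k} (s≤s k≤n) = begin
    ℤ.+ 3 ℤ.* (a k ℤ.* b (n ∸ k))              ≡⟨ ℤ*.x∙yz≈y∙xz (ℤ.+ 3) (a k) (b (n ∸ k)) ⟩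
    a k ℤ.* (ℤ.+ 3 ℤ.* b (n ∸ k))              ≡⟨ cong (a k ℤ.*_) (ω²Coeff-trace (n ∸ k)) ⟩
    a k ℤ.* trace (α * Z (n ∸ k) (n ∸ k))      ≡⟨ trace-ι* (a k) (α * Z (n ∸ k) (n ∸ k)) ⟨
    trace (ι (a k) * (α * Z (n ∸ k) (n ∸ k)))  ≡⟨ cong trace (ℤω*.x∙yz≈y∙xz (ι (a k)) α (Z (n ∸ k) (n ∸ k))) ⟩
    trace (α * (ι (a k) * Z (n ∸ k) (n ∸ k)))  ≡⟨ cong (λ x → trace (α * x)) (cong₂ _*_ N-stable Z-stable) ⟩
    trace (α * (N n k * Z n (n ∸ k)))          ∎
    where
    N-stable : ι (a k) ≡ N n k
    N-stable = trans (nonMultipleCoeff-ι k) (cong (∑ nonMultipleWeight) (sym (partsLe-stable k≤n)))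
    Z-stable : Z (n ∸ k) (n ∸ k) ≡ Z n (n ∸ k)
    Z-stable = cong (∑ ω²Weight) (sym (partsLe-stable (ℕ.m∸n≤m n k)))

theorem33 : (n : ℕ) → lhsCoeff n ≡ rhsCoeff n
theorem33 n = ℤ.*-cancelˡ-≡ (ℤ.+ 3) (lhsCoeff n) (rhsCoeff n) (begin
  ℤ.+ 3 ℤ.* lhsCoeff n                              ≡⟨ lhsCoeff-trace n ⟩
  trace (α * distinctSeries n n)                    ≡⟨ cong (λ x → trace (α * x)) (nonMultiple⊛ω²≗[]distinct n n ℕ.≤-refl) ⟨
  trace (α * (nonMultipleSeries n ⊛ ω²Series n) n)  ≡⟨ rhsCoeff-trace n ⟨
  ℤ.+ 3 ℤ.* rhsCoeff n                              ∎)
  where open ≡-Reasoning
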